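{- Let $1\le k\le n$. All matchings in a given interlacing orbit of the action of $\mathcal G$ on $\mathcal M$ have the same sign.
   Context: Let $\mathcal M$ be the set of $k$-edge matchings of $K_{n,n}$ (left and right vertices each labelled $1,\dots,n$), each identified with a bijection $\tau:I\to J$ between $k$-element subsets of $[n]$, with edges $i\to\tau(i)$. Writing $I=\{i_1<\dots<i_k\}$, $J=\{j_1<\dots<j_k\}$ and $\tau(i_m)=j_{\pi(m)}$ with $\pi\in S_k$, $\operatorname{sgn}(\tau)=\operatorname{sgn}(\pi)$. Clusters: add an auxiliary edge $r\to r$ for each $r\in I\cap J$; components of the resulting multigraph are paths, closed (cycles, including a double edge $r\to r$) or open. Removing the auxiliary edges, the edges of $\tau$ in each component form a cluster, closed or open according to the component. Flip group: $\mathcal G$ is the direct sum of copies of $\mathbb Z/2$ indexed by pairs $i<j$ in $[n]$, with generators $f_{ij}$, acting on $\mathcal M$ by: if $\tau$ has an open cluster $C$ containing the edge $i\to j$ or $j\to i$, then $f_{ij}\cdot\tau$ replaces every edge $a\to b$ of $C$ by $b\to a$ (other edges unchanged); otherwise $f_{ij}\cdot\tau=\tau$. A matching $\tau:I\to J$ is interlacing if $i_1\le j_1\le i_2\le j_2\le\dots\le i_k\le j_k$; an interlacing orbit is a $\mathcal G$-orbit containing an interlacing matching. -}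

module Defs where

open import Data.Nat using (ℕ; zero; suc; _+_)
open import Data.Fin as Fin using (Fin)
open import Data.Fin.Properties using (_≟_; any?)
open import Data.Maybe using (Maybe; just; nothing; is-just)
open import Data.Maybe.Properties using (≡-dec)
open import Data.Bool using (Bool; true; false; if_then_else_; _∧_; T)
open import Data.Bool.Properties using (T?)
open import Data.Integer using (ℤ; 1ℤ; -_)
open import Data.List using (List; []; _∷_; filter)
open import Data.List using () renaming (allFin to allFinL)
open import Data.Product using (Σ; ∃; ∃₂; _×_; _,_)
open import Data.Sum using (_⊎_)
open import Data.Unit using (⊤)
open import Data.Empty using (⊥)
open import Function using (_∘_; _⇔_)
open import Relation.Nullary using (¬_; Dec; yes; no)
open import Relation.Nullary.Decidable using (⌊_⌋)
open import Relation.Binary.PropositionalEquality using (_≡_)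
open import Relation.Binary.Construct.Closure.ReflexiveTransitive using (Star)
open import Relation.Binary.Construct.Closure.Equivalence using (EqClosure)

-- A partial map τ : I → J ⊆ [n] (here [n] = Fin n); I = domain, J = image.

PMap : ℕ → Set
PMap n = Fin n → Maybe (Fin n)

PInjective : ∀ {n} → PMap n → Set
PInjective τ = ∀ a b c → τ a ≡ just c → τ b ≡ just c → a ≡ b

count : ∀ {n} → (Fin n → Bool) → ℕ
count {zero}  p = 0
count {suc n} p = (if p Fin.zero then 1 else 0) + count (p ∘ Fin.suc)

sumFin : ∀ {n} → (Fin n → ℕ) → ℕ
sumFin {zero}  f = 0
sumFin {suc n} f = f Fin.zero + sumFin (f ∘ Fin.suc)

-- a k-edge matching of K_{n,n}: a partial injection with |I| = k
record Matching (n k : ℕ) : Set where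
  field
    τ    : PMap n
    inj  : PInjective τ
    size : count (λ x → is-just (τ x)) ≡ k
open Matching public

InDom : ∀ {n} → PMap n → Fin n → Set
InDom τ x = ∃ λ y → τ x ≡ just y

InRan : ∀ {n} → PMap n → Fin n → Set
InRan τ y = ∃ λ x → τ x ≡ just y

InRan? : ∀ {n} (τ : PMap n) (y : Fin n) → Dec (InRan τ y)
InRan? τ y = any? (λ x → ≡-dec _≟_ (τ x) (just y))

-- Sign: sgn(π) = (-1)^(number of inversions of π), and the inversions of π
-- correspond exactly to pairs a < b in I with τ(b) < τ(a).

inv : ∀ {n} → PMap n → Fin n → Fin n → Bool
inv τ a b with τ a | τ b
... | just c | just d = ⌊ a Fin.<? b ⌋ ∧ ⌊ d Fin.<? c ⌋
... | _      | _      = false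

inversions : ∀ {n} → PMap n → ℕ
inversions τ = sumFin (λ a → count (λ b → inv τ a b))

negOnePow : ℕ → ℤ
negOnePow zero    = 1ℤ
negOnePow (suc m) = - negOnePow m

sgn : ∀ {n k} → Matching n k → ℤ
sgn m = negOnePow (inversions (τ m))

-- Interlacing: i₁ ≤ j₁ ≤ i₂ ≤ j₂ ≤ … ≤ i_k ≤ j_k

domList : ∀ {n} → PMap n → List (Fin n)
domList {n} τ = filter (λ x → T? (is-just (τ x))) (allFinL n)

ranList : ∀ {n} → PMap n → List (Fin n)
ranList {n} τ = filter (InRan? τ) (allFinL n)

AtMostHead : ∀ {n} → Fin n → List (Fin n) → Set
AtMostHead j []      = ⊤
AtMostHead j (i ∷ _) = j Fin.≤ i

Interlaces : ∀ {n} → List (Fin n) → List (Fin n) → Set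
Interlaces []       []       = ⊤
Interlaces (i ∷ is) (j ∷ js) = i Fin.≤ j × AtMostHead j is × Interlaces is js
Interlaces _        _        = ⊥

Interlacing : ∀ {n k} → Matching n k → Set
Interlacing m = Interlaces (domList (τ m)) (ranList (τ m))

-- Adding the auxiliary edges r → r (r ∈ I ∩ J) and contracting
-- them, components of the multigraph are the components of the graph on
-- [n] with edges {x, τ x}.  A component is open (a path) iff it contains a
-- vertex of degree 1, i.e. a vertex in I Δ J.

Adj : ∀ {n} → PMap n → Fin n → Fin n → Set
Adj τ x y = τ x ≡ just y ⊎ τ y ≡ just x

Conn : ∀ {n} → PMap n → Fin n → Fin n → Set
Conn τ = Star (Adj τ)

Deg1 : ∀ {n} → PMap n → Fin n → Set
Deg1 τ x = (InDom τ x × ¬ InRan τ x) ⊎ (¬ InDom τ x × InRan τ x)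

OpenAt : ∀ {n} → PMap n → Fin n → Set
OpenAt τ i = ∃ λ x → Conn τ i x × Deg1 τ x

HasOpenClusterWith : ∀ {n} → PMap n → Fin n → Fin n → Set
HasOpenClusterWith τ i j = (τ i ≡ just j ⊎ τ j ≡ just i) × OpenAt τ i

-- The flip f_{ij}, as its graph: Flip i j τ τ' means τ' = f_{ij} · τ.

Flip : ∀ {n} → Fin n → Fin n → PMap n → PMap n → Set
Flip i j τ τ' =
    (HasOpenClusterWith τ i j ×
      (∀ x → (Conn τ i x → ∀ y → (τ' x ≡ just y ⇔ τ y ≡ just x))
           × (¬ Conn τ i x → τ' x ≡ τ x)))
  ⊎ (¬ HasOpenClusterWith τ i j × (∀ x → τ' x ≡ τ x))

Step : ∀ {n k} → Matching n k → Matching n k → Set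
Step m m' = ∃₂ λ i j → i Fin.< j × Flip i j (τ m) (τ m')

SameOrbit : ∀ {n k} → Matching n k → Matching n k → Set
SameOrbit = EqClosure Step

-- Modulo 2, the number of inversions of a matching τ with edge indicator e is the number
-- Q(e) = Σ e(a,c) e(b,d) [a < b] [d < c] of crossing pairs of edges, a quadratic form over 𝔽₂.
-- A flip reverses the edges u of an open cluster and keeps the remaining edges v, which share no
-- vertex with u.  Expanding Q bilinearly, and using that the four orientations of a pair of
-- vertex-disjoint edges differ exactly in the comparisons between their endpoints, gives
-- Q(uᵀ + v) = Q(u + v) + Σ_{w < x} deg u(w) deg v(x), where only vertices of odd degree, that is of
-- I Δ J, contribute.  Flips preserve the underlying undirected graph, hence I Δ J and the clusters
-- of the interlacing matching.  There the elements of I Δ J alternate between I ∖ J and J ∖ I, and a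
-- union χ of clusters contains equally many, say a, of each; so the correction term is
-- a + C(2a, 2) ≡ 0 (mod 2).

module Submission where

open import Defs
open import Data.Nat using (ℕ; _≤_)
open import Relation.Binary.PropositionalEquality using (_≡_)

open import Level using (0ℓ)
open import Algebra.Bundles using (Monoid; CommutativeRing)
import Data.Nat.Properties as ℕ
import Data.Bool as Bool
open import Data.Bool using (Bool; true; false; not; _∧_; _∨_; _xor_; if_then_else_)
open import Data.Bool.Properties
  using (xor-∧-commutativeRing; ∧-comm; ∧-identityʳ; ∧-zeroʳ; xor-identityʳ; ∧-distribˡ-xor; ∨-comm; xor-comm; xor-same; xor-inverseˡ)
open import Data.Empty using (⊥; ⊥-elim)
open import Data.Fin using (Fin; zero; suc; toℕ)
open import Data.Fin.Properties using (_≟_; _<?_; <-cmp; <-asym; suc-injective)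
open import Data.Nat.Combinatorics using (_C_; nC1≡n; nCk+nC[k+1]≡[n+1]C[k+1])
open import Data.Integer using (ℤ; 1ℤ; -_)
open import Data.List using (List; []; _∷_; filter; tabulate)
open import Data.Maybe using (Maybe; just; nothing; maybe′; is-just)
open import Data.Maybe.Properties using (≡-dec; just-injective)
open import Data.Nat using (zero; suc; _+_; _<_; z≤n; s≤s; s≤s⁻¹)
open import Function using (id; _∘_; _⇔_; Equivalence)
open import Relation.Binary.PropositionalEquality using (refl; sym; trans; cong; cong₂; subst₂; _≢_; ≢-sym; module ≡-Reasoning)
open import Relation.Nullary using (¬_; Dec; yes; no; does)
open import Relation.Nullary.Decidable using (⌊_⌋; T?; dec-true; dec-false; decidable-stable)
open import Relation.Binary.Definitions using (tri<; tri≈; tri>)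
open import Data.Product using (_×_; _,_; proj₁; proj₂)
open import Data.Sum using (_⊎_; inj₁; inj₂)
open import Relation.Binary.Construct.Closure.ReflexiveTransitive as Star using (_◅_; _◅◅_)
open import Relation.Binary.Construct.Closure.Symmetric using (SymClosure; fwd; bwd)
open import Tactic.RingSolver.Core.AlmostCommutativeRing using (AlmostCommutativeRing; fromCommutativeRing)
open import Tactic.RingSolver using (solve-∀)

open CommutativeRing xor-∧-commutativeRing using (semiring; +-monoid)
import Algebra.Properties.Semiring.Sum
open Algebra.Properties.Semiring.Sum semiring
  using (sum; sum-syntax; sum-cong-≗; sum-replicate-zero; ∑-distrib-+; ∑-comm; *-distribˡ-sum; *-distribʳ-sum)
module ℕ∑ = Algebra.Properties.Semiring.Sum ℕ.+-*-semiring
open import Algebra.Properties.Monoid.Mult +-monoid using (×-homo-+) renaming (_×_ to _times_)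

-- Sums over Fin n, parity and sign

𝔽₂ : AlmostCommutativeRing 0ℓ 0ℓ
𝔽₂ = fromCommutativeRing xor-∧-commutativeRing false≟
  where
  false≟ : ∀ b → Maybe (false ≡ b)
  false≟ false = just refl
  false≟ true  = nothing

sum-false : ∀ n → ∑[ x < n ] false ≡ false
sum-false n = sum-replicate-zero n

module _ {c ℓ} (M : Monoid c ℓ) where
  open Monoid M using (Carrier; _≈_; ε; ∙-congˡ; ∙-congʳ; identityˡ; identityʳ) renaming (trans to ≈-trans)
  open import Algebra.Properties.Monoid.Sum M using () renaming (sum to ∑; sum-cong-≋ to ∑-cong; sum-replicate-zero to ∑-ε)

  sum-singleton : ∀ {n} (f : Fin n → Carrier) (x : Fin n) → (∀ y → y ≢ x → f y ≈ ε) → ∑ f ≈ f x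
  sum-singleton {suc n} f zero    off =
    ≈-trans (∙-congˡ (≈-trans (∑-cong (λ y → off (suc y) λ ())) (∑-ε n))) (identityʳ (f zero))
  sum-singleton {suc n} f (suc x) off =
    ≈-trans (∙-congʳ (off zero λ ()))
            (≈-trans (identityˡ _) (sum-singleton (f ∘ suc) x (λ y y≢x → off (suc y) (y≢x ∘ suc-injective))))

nothing≢just : ∀ {a} {A : Set a} {x : A} → nothing ≢ just x
nothing≢just ()

does-⇔ : ∀ {a b} {A : Set a} {B : Set b} → A ⇔ B → (a? : Dec A) (b? : Dec B) → does a? ≡ does b?
does-⇔ A⇔B (yes _)  (yes _)  = refl
does-⇔ A⇔B (yes a)  (no ¬b) = ⊥-elim (¬b (Equivalence.to A⇔B a))
does-⇔ A⇔B (no ¬a) (yes b)  = ⊥-elim (¬a (Equivalence.from A⇔B b))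
does-⇔ A⇔B (no _)   (no _)   = refl

true-false-≢ : ∀ {x y : Bool} → x ≡ true → y ≡ false → x ≢ y
true-false-≢ refl refl ()

𝟙 : Bool → ℕ
𝟙 b = if b then 1 else 0

parity : ℕ → Bool
parity m = m times true

parity-+ : ∀ m m′ → parity (m + m′) ≡ parity m xor parity m′
parity-+ m m′ = ×-homo-+ true m m′

parity-𝟙 : ∀ b → parity (𝟙 b) ≡ b
parity-𝟙 true  = refl
parity-𝟙 false = refl

parity-count : ∀ {n} (p : Fin n → Bool) → parity (count p) ≡ sum p
parity-count {zero}  p = refl
parity-count {suc n} p = trans (parity-+ (𝟙 (p zero)) (count (p ∘ suc)))
                               (cong₂ _xor_ (parity-𝟙 (p zero)) (parity-count (p ∘ suc)))

parity-sumFin : ∀ {n} (f : Fin n → ℕ) → parity (sumFin f) ≡ sum (parity ∘ f)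
parity-sumFin {zero}  f = refl
parity-sumFin {suc n} f = trans (parity-+ (f zero) (sumFin (f ∘ suc)))
                                (cong (parity (f zero) xor_) (parity-sumFin (f ∘ suc)))

negOnePow-parity : ∀ m → negOnePow m ≡ (if parity m then - 1ℤ else 1ℤ)
negOnePow-parity zero    = refl
negOnePow-parity (suc m) rewrite negOnePow-parity m with parity m
... | true  = refl
... | false = refl

negOnePow-cong : ∀ m m′ → parity m ≡ parity m′ → negOnePow m ≡ negOnePow m′
negOnePow-cong m m′ eq rewrite negOnePow-parity m | negOnePow-parity m′ | eq = refl

count-sum : ∀ {n} (p : Fin n → Bool) → count p ≡ ℕ∑.sum (𝟙 ∘ p)
count-sum {zero}  p = refl
count-sum {suc n} p = cong (𝟙 (p zero) +_) (count-sum (p ∘ suc))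

module _ {n : ℕ} where

  count-cong : ∀ {p q : Fin n → Bool} → (∀ x → p x ≡ q x) → count p ≡ count q
  count-cong {p} {q} p≗q = trans (count-sum p) (trans (ℕ∑.sum-cong-≗ (cong 𝟙 ∘ p≗q)) (sym (count-sum q)))

  count-split : ∀ {p q r : Fin n → Bool} → (∀ x → 𝟙 (r x) ≡ 𝟙 (p x) + 𝟙 (q x)) → count r ≡ count p + count q
  count-split {p} {q} {r} split = begin
    count r                                ≡⟨ count-sum r ⟩
    ℕ∑.sum (𝟙 ∘ r)                         ≡⟨ ℕ∑.sum-cong-≗ split ⟩
    ℕ∑.sum (λ x → 𝟙 (p x) + 𝟙 (q x))       ≡⟨ ℕ∑.∑-distrib-+ (𝟙 ∘ p) (𝟙 ∘ q) ⟩
    ℕ∑.sum (𝟙 ∘ p) + ℕ∑.sum (𝟙 ∘ q)       ≡⟨ cong₂ _+_ (count-sum p) (count-sum q) ⟨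
    count p + count q                      ∎
    where open ≡-Reasoning

  count-false : count {n} (λ _ → false) ≡ 0
  count-false = trans (count-sum {n} (λ _ → false)) (ℕ∑.sum-replicate-zero n)

  count-singleton : ∀ (p : Fin n → Bool) x → (∀ y → y ≢ x → p y ≡ false) → count p ≡ 𝟙 (p x)
  count-singleton p x off = trans (count-sum p) (sum-singleton ℕ.+-0-monoid (𝟙 ∘ p) x (λ y y≢x → cong 𝟙 (off y y≢x)))

-- Crossings of digraphs on Fin n

Digraph : ℕ → Set
Digraph n = Fin n → Fin n → Bool

module _ {n : ℕ} where

  ∑² : Digraph n → Bool
  ∑² f = ∑[ a < n ] ∑[ c < n ] f a c

  ∑²-cong : ∀ {f g : Digraph n} → (∀ a c → f a c ≡ g a c) → ∑² f ≡ ∑² g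
  ∑²-cong f≗g = sum-cong-≗ (λ a → sum-cong-≗ (f≗g a))

  ∑²-distrib-xor : ∀ (f g : Digraph n) → ∑² (λ a c → f a c xor g a c) ≡ ∑² f xor ∑² g
  ∑²-distrib-xor f g = trans (sum-cong-≗ (λ a → ∑-distrib-+ (f a) (g a))) (∑-distrib-+ (λ a → sum (f a)) (λ a → sum (g a)))

  ∑²-distrib-xor₄ : ∀ (f₁ f₂ f₃ f₄ : Digraph n) →
    ∑² (λ a c → f₁ a c xor f₂ a c xor f₃ a c xor f₄ a c) ≡ ∑² f₁ xor ∑² f₂ xor ∑² f₃ xor ∑² f₄
  ∑²-distrib-xor₄ f₁ f₂ f₃ f₄ = trans (∑²-distrib-xor f₁ _) (cong (∑² f₁ xor_)
                                 (trans (∑²-distrib-xor f₂ _) (cong (∑² f₂ xor_) (∑²-distrib-xor f₃ f₄))))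

  ∑²-transpose : ∀ (f : Digraph n) → ∑² f ≡ ∑² (λ a c → f c a)
  ∑²-transpose f = ∑-comm f

  ∑²-comm : ∀ (f : Fin n → Fin n → Digraph n) →
            ∑² (λ a c → ∑² (λ b d → f a c b d)) ≡ ∑² (λ b d → ∑² (λ a c → f a c b d))
  ∑²-comm f = begin
    ∑[ a < n ] ∑[ c < n ] ∑[ b < n ] ∑[ d < n ] f a c b d  ≡⟨ sum-cong-≗ (λ a → ∑-comm (λ c b → ∑[ d < n ] f a c b d)) ⟩
    ∑[ a < n ] ∑[ b < n ] ∑[ c < n ] ∑[ d < n ] f a c b d  ≡⟨ sum-cong-≗ (λ a → sum-cong-≗ (λ b → ∑-comm (λ c d → f a c b d))) ⟩
    ∑[ a < n ] ∑[ b < n ] ∑[ d < n ] ∑[ c < n ] f a c b d  ≡⟨ ∑-comm (λ a b → ∑[ d < n ] ∑[ c < n ] f a c b d) ⟩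
    ∑[ b < n ] ∑[ a < n ] ∑[ d < n ] ∑[ c < n ] f a c b d  ≡⟨ sum-cong-≗ (λ b → ∑-comm (λ a d → ∑[ c < n ] f a c b d)) ⟩
    ∑[ b < n ] ∑[ d < n ] ∑[ a < n ] ∑[ c < n ] f a c b d  ∎
    where open ≡-Reasoning

  ∑²-factor : ∀ (p q R : Digraph n) →
              ∑² (λ a c → ∑² (λ b d → p a c ∧ q b d ∧ R a b)) ≡ ∑² (λ a b → sum (p a) ∧ sum (q b) ∧ R a b)
  ∑²-factor p q R = trans (sum-cong-≗ (λ a → ∑-comm (λ c b → ∑[ d < n ] (p a c ∧ q b d ∧ R a b))))
                          (∑²-cong factor)
    where
    open ≡-Reasoning
    factor : ∀ a b → ∑[ c < n ] ∑[ d < n ] (p a c ∧ q b d ∧ R a b) ≡ sum (p a) ∧ sum (q b) ∧ R a b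
    factor a b = begin
      ∑[ c < n ] ∑[ d < n ] (p a c ∧ q b d ∧ R a b)  ≡⟨ sum-cong-≗ (λ c → *-distribˡ-sum (p a c) (λ d → q b d ∧ R a b)) ⟨
      ∑[ c < n ] (p a c ∧ ∑[ d < n ] (q b d ∧ R a b)) ≡⟨ sum-cong-≗ (λ c → cong (p a c ∧_) (*-distribʳ-sum (R a b) (q b))) ⟨
      ∑[ c < n ] (p a c ∧ sum (q b) ∧ R a b)         ≡⟨ *-distribʳ-sum (sum (q b) ∧ R a b) (p a) ⟨
      sum (p a) ∧ sum (q b) ∧ R a b                  ∎

  infix  8 _ᵀ
  infixl 6 _⊕_

  _ᵀ : Digraph n → Digraph n
  (e ᵀ) a c = e c a

  _⊕_ : Digraph n → Digraph n → Digraph n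
  (x ⊕ y) a c = x a c xor y a c

  outdeg indeg deg : Digraph n → Fin n → Bool
  outdeg e a = sum (e a)
  indeg e = outdeg (e ᵀ)
  deg e w = outdeg e w xor indeg e w

  _<ᵇ_ : Fin n → Fin n → Bool
  a <ᵇ b = ⌊ a <? b ⌋

  crossings : Digraph n → Digraph n → Bool
  crossings x y = ∑² λ a c → ∑² λ b d → x a c ∧ y b d ∧ a <ᵇ b ∧ d <ᵇ c

  crossings-cong : ∀ {x x′ y y′} → (∀ a c → x a c ≡ x′ a c) → (∀ a c → y a c ≡ y′ a c) →
                   crossings x y ≡ crossings x′ y′
  crossings-cong x≗x′ y≗y′ = ∑²-cong (λ a c → ∑²-cong (λ b d → cong₂ (λ p q → p ∧ q ∧ _) (x≗x′ a c) (y≗y′ b d)))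

  crossings-⊕ˡ : ∀ x y z → crossings (x ⊕ y) z ≡ crossings x z xor crossings y z
  crossings-⊕ˡ x y z = trans (∑²-cong (λ a c → trans (∑²-cong (λ b d → distrib (x a c) (y a c) (z b d) (a <ᵇ b ∧ d <ᵇ c)))
                                                      (∑²-distrib-xor _ _)))
                             (∑²-distrib-xor _ _)
    where
    distrib : ∀ p q r l → (p xor q) ∧ r ∧ l ≡ (p ∧ r ∧ l) xor (q ∧ r ∧ l)
    distrib = solve-∀ 𝔽₂

  crossings-⊕ʳ : ∀ x y z → crossings x (y ⊕ z) ≡ crossings x y xor crossings x z
  crossings-⊕ʳ x y z = trans (∑²-cong (λ a c → trans (∑²-cong (λ b d → distrib (x a c) (y b d) (z b d) (a <ᵇ b ∧ d <ᵇ c)))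
                                                      (∑²-distrib-xor _ _)))
                             (∑²-distrib-xor _ _)
    where
    distrib : ∀ p q r l → p ∧ (q xor r) ∧ l ≡ (p ∧ q ∧ l) xor (p ∧ r ∧ l)
    distrib = solve-∀ 𝔽₂

  crossings-⊕ : ∀ x y → crossings (x ⊕ y) (x ⊕ y) ≡ (crossings x x xor crossings y y) xor (crossings x y xor crossings y x)
  crossings-⊕ x y = begin
    crossings (x ⊕ y) (x ⊕ y)
      ≡⟨ crossings-⊕ˡ x y (x ⊕ y) ⟩
    crossings x (x ⊕ y) xor crossings y (x ⊕ y)
      ≡⟨ cong₂ _xor_ (crossings-⊕ʳ x x y) (crossings-⊕ʳ y x y) ⟩
    (crossings x x xor crossings x y) xor (crossings y x xor crossings y y)
      ≡⟨ shuffle (crossings x x) (crossings x y) (crossings y x) (crossings y y) ⟩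
    (crossings x x xor crossings y y) xor (crossings x y xor crossings y x) ∎
    where
    open ≡-Reasoning
    shuffle : ∀ p q r s → (p xor q) xor (r xor s) ≡ (p xor s) xor (q xor r)
    shuffle = solve-∀ 𝔽₂

  crossings-ᵀ : ∀ x y → crossings (x ᵀ) (y ᵀ) ≡ crossings y x
  crossings-ᵀ x y = begin
    crossings (x ᵀ) (y ᵀ)
      ≡⟨ ∑²-transpose _ ⟩
    ∑² (λ a c → ∑² λ b d → x a c ∧ y d b ∧ c <ᵇ b ∧ d <ᵇ a)
      ≡⟨ ∑²-cong (λ a c → ∑²-transpose _) ⟩
    ∑² (λ a c → ∑² λ b d → x a c ∧ y b d ∧ c <ᵇ d ∧ b <ᵇ a)
      ≡⟨ ∑²-cong (λ a c → ∑²-cong (λ b d → reorder (x a c) (y b d) (c <ᵇ d) (b <ᵇ a))) ⟩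
    ∑² (λ a c → ∑² λ b d → y b d ∧ x a c ∧ b <ᵇ a ∧ c <ᵇ d)
      ≡⟨ ∑²-comm (λ a c b d → y b d ∧ x a c ∧ b <ᵇ a ∧ c <ᵇ d) ⟩
    crossings y x ∎
    where
    open ≡-Reasoning
    reorder : ∀ p q r s → p ∧ q ∧ r ∧ s ≡ q ∧ p ∧ s ∧ r
    reorder = solve-∀ 𝔽₂

  <ᵇ-flip : ∀ {a b} → a ≢ b → b <ᵇ a ≡ not (a <ᵇ b)
  <ᵇ-flip {a} {b} a≢b with a <? b | b <? a
  ... | yes a<b | yes b<a = ⊥-elim (<-asym a<b b<a)
  ... | yes _   | no _    = refl
  ... | no _    | yes _   = refl
  ... | no a≮b  | no b≮a with <-cmp a b
  ...   | tri< a<b _ _ = ⊥-elim (a≮b a<b)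
  ...   | tri≈ _ a≡b _ = ⊥-elim (a≢b a≡b)
  ...   | tri> _ _ b<a = ⊥-elim (b≮a b<a)

  -- the four terms on the left are the crossing conditions for the four orientations of a → c and b → d
  orientation-sum : ∀ {a c b d} → a ≢ b → c ≢ b → a ≢ d → c ≢ d →
    (a <ᵇ b ∧ d <ᵇ c) xor (c <ᵇ b ∧ d <ᵇ a) xor (a <ᵇ d ∧ b <ᵇ c) xor (c <ᵇ d ∧ b <ᵇ a) ≡
    a <ᵇ b xor c <ᵇ b xor a <ᵇ d xor c <ᵇ d
  orientation-sum {a} {c} {b} {d} a≢b c≢b a≢d c≢d
    rewrite <ᵇ-flip c≢d | <ᵇ-flip a≢d | <ᵇ-flip c≢b | <ᵇ-flip a≢b = cancel (a <ᵇ b) (c <ᵇ b) (a <ᵇ d) (c <ᵇ d)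
    where
    cancel : ∀ p q r s → (p ∧ (true xor s)) xor (q ∧ (true xor r)) xor (r ∧ (true xor q)) xor (s ∧ (true xor p)) ≡
                         p xor q xor r xor s
    cancel = solve-∀ 𝔽₂

  module _ (χ : Fin n → Bool) (u v : Digraph n)
           (u-inside  : ∀ a c → u a c ≡ true → χ a ≡ true × χ c ≡ true)
           (v-outside : ∀ b d → v b d ≡ true → χ b ≡ false × χ d ≡ false) where

    private
      across : (Fin n → Fin n → Digraph n) → Bool
      across R = ∑² λ a c → ∑² λ b d → u a c ∧ v b d ∧ R a c b d

      across-xor : ∀ R R′ → across (λ a c b d → R a c b d xor R′ a c b d) ≡ across R xor across R′
      across-xor R R′ = trans (∑²-cong (λ a c → trans (∑²-cong (λ b d → distrib (u a c) (v b d) (R a c b d) (R′ a c b d)))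
                                                       (∑²-distrib-xor _ _)))
                              (∑²-distrib-xor _ _)
        where
        distrib : ∀ p q r s → p ∧ q ∧ (r xor s) ≡ (p ∧ q ∧ r) xor (p ∧ q ∧ s)
        distrib = solve-∀ 𝔽₂

      across-xor₄ : ∀ R₁ R₂ R₃ R₄ →
        across (λ a c b d → R₁ a c b d xor R₂ a c b d xor R₃ a c b d xor R₄ a c b d) ≡
        across R₁ xor across R₂ xor across R₃ xor across R₄
      across-xor₄ R₁ R₂ R₃ R₄ = trans (across-xor R₁ _) (cong (across R₁ xor_)
                                  (trans (across-xor R₂ _) (cong (across R₂ xor_) (across-xor R₃ R₄))))

      different : ∀ {x y} → χ x ≡ true → χ y ≡ false → x ≢ y
      different χx χy x≡y = true-false-≢ χx χy (cong χ x≡y)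

      orientations : ∀ a c b d →
        u a c ∧ v b d ∧ ((a <ᵇ b ∧ d <ᵇ c) xor (c <ᵇ b ∧ d <ᵇ a) xor (a <ᵇ d ∧ b <ᵇ c) xor (c <ᵇ d ∧ b <ᵇ a)) ≡
        u a c ∧ v b d ∧ (a <ᵇ b xor c <ᵇ b xor a <ᵇ d xor c <ᵇ d)
      orientations a c b d with u a c in uac | v b d in vbd
      ... | false | _     = refl
      ... | true  | false = refl
      ... | true  | true  with u-inside a c uac | v-outside b d vbd
      ...   | χa , χc | χb , χd =
        cong (λ t → true ∧ true ∧ t) (orientation-sum (different χa χb) (different χc χb) (different χa χd) (different χc χd))

    crossings-orientations :
      crossings u v xor crossings (u ᵀ) v xor crossings u (v ᵀ) xor crossings (u ᵀ) (v ᵀ) ≡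
      ∑² (λ w x → deg u w ∧ deg v x ∧ w <ᵇ x)
    crossings-orientations = begin
      crossings u v xor crossings (u ᵀ) v xor crossings u (v ᵀ) xor crossings (u ᵀ) (v ᵀ)
        ≡⟨ cong₂ (λ y z → crossings u v xor y xor z) (∑²-transpose _)
                 (cong₂ _xor_ (∑²-cong (λ a c → ∑²-transpose _))
                              (trans (∑²-transpose _) (∑²-cong (λ a c → ∑²-transpose _)))) ⟩
      across (λ a c b d → a <ᵇ b ∧ d <ᵇ c) xor across (λ a c b d → c <ᵇ b ∧ d <ᵇ a) xor
      across (λ a c b d → a <ᵇ d ∧ b <ᵇ c) xor across (λ a c b d → c <ᵇ d ∧ b <ᵇ a)
        ≡⟨ across-xor₄ _ _ _ _ ⟨
      across (λ a c b d → (a <ᵇ b ∧ d <ᵇ c) xor (c <ᵇ b ∧ d <ᵇ a) xor (a <ᵇ d ∧ b <ᵇ c) xor (c <ᵇ d ∧ b <ᵇ a))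
        ≡⟨ ∑²-cong (λ a c → ∑²-cong (λ b d → orientations a c b d)) ⟩
      across (λ a c b d → a <ᵇ b xor c <ᵇ b xor a <ᵇ d xor c <ᵇ d)
        ≡⟨ across-xor₄ _ _ _ _ ⟩
      across (λ a c b d → a <ᵇ b) xor across (λ a c b d → c <ᵇ b) xor
      across (λ a c b d → a <ᵇ d) xor across (λ a c b d → c <ᵇ d)
        ≡⟨ cong₂ _xor_ (∑²-factor u v _<ᵇ_)
             (cong₂ _xor_ (trans (∑²-transpose _) (∑²-factor (u ᵀ) v _<ᵇ_))
               (cong₂ _xor_ (trans (∑²-cong (λ a c → ∑²-transpose _)) (∑²-factor u (v ᵀ) _<ᵇ_))
                 (trans (trans (∑²-transpose _) (∑²-cong (λ a c → ∑²-transpose _))) (∑²-factor (u ᵀ) (v ᵀ) _<ᵇ_)))) ⟩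
      ∑² (λ w x → outdeg u w ∧ outdeg v x ∧ w <ᵇ x) xor ∑² (λ w x → indeg u w ∧ outdeg v x ∧ w <ᵇ x) xor
      ∑² (λ w x → outdeg u w ∧ indeg v x ∧ w <ᵇ x) xor ∑² (λ w x → indeg u w ∧ indeg v x ∧ w <ᵇ x)
        ≡⟨ ∑²-distrib-xor₄ _ _ _ _ ⟨
      ∑² (λ w x → (outdeg u w ∧ outdeg v x ∧ w <ᵇ x) xor (indeg u w ∧ outdeg v x ∧ w <ᵇ x) xor
                  (outdeg u w ∧ indeg v x ∧ w <ᵇ x) xor (indeg u w ∧ indeg v x ∧ w <ᵇ x))
        ≡⟨ ∑²-cong (λ w x → collect (outdeg u w) (indeg u w) (outdeg v x) (indeg v x) (w <ᵇ x)) ⟩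
      ∑² (λ w x → deg u w ∧ deg v x ∧ w <ᵇ x) ∎
      where
      open ≡-Reasoning
      collect : ∀ p q r s l → (p ∧ r ∧ l) xor (q ∧ r ∧ l) xor (p ∧ s ∧ l) xor (q ∧ s ∧ l) ≡ (p xor q) ∧ (r xor s) ∧ l
      collect = solve-∀ 𝔽₂

    crossings-reverse : crossings (u ᵀ ⊕ v) (u ᵀ ⊕ v) ≡
                        crossings (u ⊕ v) (u ⊕ v) xor ∑² (λ w x → deg u w ∧ deg v x ∧ w <ᵇ x)
    crossings-reverse = begin
      crossings (u ᵀ ⊕ v) (u ᵀ ⊕ v)
        ≡⟨ crossings-⊕ (u ᵀ) v ⟩
      (crossings (u ᵀ) (u ᵀ) xor crossings v v) xor (crossings (u ᵀ) v xor crossings v (u ᵀ))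
        ≡⟨ cong₂ (λ y z → (y xor crossings v v) xor (crossings (u ᵀ) v xor z)) (crossings-ᵀ u u) (crossings-ᵀ (v ᵀ) u) ⟩
      (crossings u u xor crossings v v) xor (crossings (u ᵀ) v xor crossings u (v ᵀ))
        ≡⟨ rearrange (crossings u u) (crossings v v) (crossings (u ᵀ) v) (crossings (u ᵀ) (v ᵀ)) (crossings u v) (crossings u (v ᵀ)) ⟩
      ((crossings u u xor crossings v v) xor (crossings u v xor crossings (u ᵀ) (v ᵀ))) xor
      (crossings u v xor crossings (u ᵀ) v xor crossings u (v ᵀ) xor crossings (u ᵀ) (v ᵀ))
        ≡⟨ cong₂ (λ y z → ((crossings u u xor crossings v v) xor (crossings u v xor y)) xor z)
                 (sym (crossings-ᵀ (v ᵀ) (u ᵀ))) crossings-orientations ⟩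
      ((crossings u u xor crossings v v) xor (crossings u v xor crossings v u)) xor ∑² (λ w x → deg u w ∧ deg v x ∧ w <ᵇ x)
        ≡⟨ cong (_xor ∑² (λ w x → deg u w ∧ deg v x ∧ w <ᵇ x)) (crossings-⊕ u v) ⟨
      crossings (u ⊕ v) (u ⊕ v) xor ∑² (λ w x → deg u w ∧ deg v x ∧ w <ᵇ x) ∎
      where
      open ≡-Reasoning
      rearrange : ∀ q q′ p t s r → (q xor q′) xor (p xor r) ≡ ((q xor q′) xor (s xor t)) xor (s xor p xor r xor t)
      rearrange = solve-∀ 𝔽₂

  -- Reversing the edges of a union of components

  Closed : (Fin n → Bool) → Digraph n → Set
  Closed χ e = ∀ a c → e a c ≡ true → χ a ≡ χ c

  restrict : (Fin n → Bool) → Digraph n → Digraph n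
  restrict χ e a c = χ a ∧ e a c

  closed-∧ : ∀ {χ e} → Closed χ e → ∀ a c → χ a ∧ e a c ≡ χ c ∧ e a c
  closed-∧ {χ} {e} closed a c with e a c in eac
  ... | true  = cong (_∧ true) (closed a c eac)
  ... | false = trans (∧-zeroʳ (χ a)) (sym (∧-zeroʳ (χ c)))

  deg-restrict : ∀ {χ e} → Closed χ e → ∀ w → deg (restrict χ e) w ≡ χ w ∧ deg e w
  deg-restrict {χ} {e} closed w = begin
    sum (λ c → χ w ∧ e w c) xor sum (λ a → χ a ∧ e a w)
      ≡⟨ cong (sum (λ c → χ w ∧ e w c) xor_) (sum-cong-≗ (λ a → closed-∧ closed a w)) ⟩
    sum (λ c → χ w ∧ e w c) xor sum (λ a → χ w ∧ e a w)
      ≡⟨ cong₂ _xor_ (*-distribˡ-sum (χ w) (e w)) (*-distribˡ-sum (χ w) (λ a → e a w)) ⟨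
    (χ w ∧ outdeg e w) xor (χ w ∧ indeg e w)
      ≡⟨ ∧-distribˡ-xor (χ w) (outdeg e w) (indeg e w) ⟨
    χ w ∧ deg e w ∎
    where open ≡-Reasoning

  record Reversal (e e′ : Digraph n) : Set where
    field
      part     : Fin n → Bool
      closed   : Closed part e
      reversed : ∀ a c → e′ a c ≡ (if part a then e c a else e a c)

    reversed-at : ∀ {a b} c → part a ≡ b → e′ a c ≡ (if b then e c a else e a c)
    reversed-at {a} c pa = trans (reversed a c) (cong (if_then e c a else e a c) pa)

    no-edge : ∀ a c → part a ≢ part c → e a c ≡ false
    no-edge a c part≢ with e a c in eac
    ... | true  = ⊥-elim (part≢ (closed a c eac))
    ... | false = refl

    reversedᵀ-at : ∀ a {c b} → part c ≡ b → e′ a c ≡ (if b then e c a else e a c)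
    reversedᵀ-at a {c} {b} pc with part a in pa | b
    ... | true  | true  = reversed-at c pa
    ... | false | false = reversed-at c pa
    ... | true  | false = trans (reversed-at c pa) (trans (no-edge c a (≢-sym a≢c)) (sym (no-edge a c a≢c)))
      where a≢c = true-false-≢ pa pc
    ... | false | true  = trans (reversed-at c pa) (trans (no-edge a c (≢-sym c≢a)) (sym (no-edge c a c≢a)))
      where c≢a = true-false-≢ pc pa

  module _ {e e′ : Digraph n} (r : Reversal e e′) where
    open Reversal r

    reversal-sym : Reversal e′ e
    reversal-sym = record { part = part ; closed = closed′ ; reversed = reversed′ }
      where
      closed′ : Closed part e′
      closed′ a c e′ac with part a in pa
      ... | true  = trans (sym pa) (sym (closed c a (trans (sym (reversed-at c pa)) e′ac)))
      ... | false = trans (sym pa) (closed a c (trans (sym (reversed-at c pa)) e′ac))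
      reversed′ : ∀ a c → e a c ≡ (if part a then e′ c a else e′ a c)
      reversed′ a c with part a in pa
      ... | true  = sym (reversedᵀ-at c pa)
      ... | false = sym (reversed-at c pa)

    reversal-adjacent : ∀ x y → (e′ x y ∨ e′ y x) ≡ (e x y ∨ e y x)
    reversal-adjacent x y with part x in px
    ... | true  = trans (cong₂ _∨_ (reversed-at y px) (reversedᵀ-at y px)) (∨-comm (e y x) (e x y))
    ... | false = cong₂ _∨_ (reversed-at y px) (reversedᵀ-at y px)

    reversal-deg : ∀ w → deg e′ w ≡ deg e w
    reversal-deg w with part w in pw
    ... | true  = trans (cong₂ _xor_ (sum-cong-≗ (λ c → reversed-at c pw)) (sum-cong-≗ (λ a → reversedᵀ-at a pw)))
                        (xor-comm (indeg e w) (outdeg e w))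
    ... | false = cong₂ _xor_ (sum-cong-≗ (λ c → reversed-at c pw)) (sum-cong-≗ (λ a → reversedᵀ-at a pw))

    reversal-crossings : crossings e′ e′ ≡
      crossings e e xor ∑² (λ w x → (part w ∧ deg e w) ∧ (not (part x) ∧ deg e x) ∧ w <ᵇ x)
    reversal-crossings = begin
      crossings e′ e′
        ≡⟨ crossings-cong e′-split e′-split ⟩
      crossings (u ᵀ ⊕ v) (u ᵀ ⊕ v)
        ≡⟨ crossings-reverse part u v inside outside ⟩
      crossings (u ⊕ v) (u ⊕ v) xor ∑² (λ w x → deg u w ∧ deg v x ∧ w <ᵇ x)
        ≡⟨ cong₂ _xor_ (sym (crossings-cong e-split e-split))
                       (∑²-cong (λ w x → cong₂ (λ p q → p ∧ q ∧ w <ᵇ x) (deg-restrict closed w) (deg-restrict closed-not x))) ⟩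
      crossings e e xor ∑² (λ w x → (part w ∧ deg e w) ∧ (not (part x) ∧ deg e x) ∧ w <ᵇ x) ∎
      where
      open ≡-Reasoning
      u v : Digraph n
      u = restrict part e
      v = restrict (not ∘ part) e

      closed-not : Closed (not ∘ part) e
      closed-not a c eac = cong not (closed a c eac)

      e-split : ∀ a c → e a c ≡ (u ⊕ v) a c
      e-split a c = split (part a) (e a c)
        where
        split : ∀ p x → x ≡ (p ∧ x) xor ((true xor p) ∧ x)
        split = solve-∀ 𝔽₂

      e′-split : ∀ a c → e′ a c ≡ (u ᵀ ⊕ v) a c
      e′-split a c with part a in pa
      ... | true  = trans (reversed-at c pa)
                      (trans (cong (_∧ e c a) (sym pa)) (trans (sym (closed-∧ closed c a)) (sym (xor-identityʳ _))))
      ... | false = trans (reversed-at c pa) (cong (_xor e a c) (sym (trans (closed-∧ closed c a) (cong (_∧ e c a) pa))))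

      inside : ∀ a c → u a c ≡ true → part a ≡ true × part c ≡ true
      inside a c uac with part a in pa
      ... | true = refl , trans (sym (closed a c uac)) pa

      outside : ∀ b d → v b d ≡ true → part b ≡ false × part d ≡ false
      outside b d vbd with part b in pb
      ... | false = refl , trans (sym (closed b d vbd)) pb

-- The digraph of a matching

module _ {n : ℕ} where

  _≟ₘ_ : (x y : Maybe (Fin n)) → Dec (x ≡ y)
  _≟ₘ_ = ≡-dec _≟_

  edges : PMap n → Digraph n
  edges τ a c = does (τ a ≟ₘ just c)

  dom ran : PMap n → Fin n → Bool
  dom τ x = is-just (τ x)
  ran τ x = does (InRan? τ x)

  module _ (τ : PMap n) (a c : Fin n) where

    edges-true : edges τ a c ≡ true → τ a ≡ just c
    edges-true h with τ a ≟ₘ just c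
    ... | yes p = p

    edges-just : τ a ≡ just c → edges τ a c ≡ true
    edges-just = dec-true (τ a ≟ₘ just c)

    edges-false : τ a ≢ just c → edges τ a c ≡ false
    edges-false = dec-false (τ a ≟ₘ just c)

    edges-nothing : τ a ≡ nothing → edges τ a c ≡ false
    edges-nothing τa = edges-false λ τa≡c → nothing≢just (trans (sym τa) τa≡c)

    edges-other : ∀ {b} → τ a ≡ just b → c ≢ b → edges τ a c ≡ false
    edges-other τa c≢b = edges-false λ τa≡c → c≢b (just-injective (trans (sym τa≡c) τa))

  sum-edges : ∀ (τ : PMap n) a (g : Fin n → Bool) → ∑[ c < n ] (edges τ a c ∧ g c) ≡ maybe′ g false (τ a)
  sum-edges τ a g = at (τ a) refl
    where
    at : ∀ m → τ a ≡ m → ∑[ c < n ] (edges τ a c ∧ g c) ≡ maybe′ g false m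
    at nothing  τa = trans (sum-cong-≗ (λ c → cong (_∧ g c) (edges-nothing τ a c τa))) (sum-false n)
    at (just b) τa = trans (sum-singleton +-monoid (λ c → edges τ a c ∧ g c) b
                                          (λ c c≢b → cong (_∧ g c) (edges-other τ a c τa c≢b)))
                           (cong (_∧ g b) (edges-just τ a b τa))

  parity-inversions : ∀ (τ : PMap n) → parity (inversions τ) ≡ crossings (edges τ) (edges τ)
  parity-inversions τ = begin
    parity (inversions τ)
      ≡⟨ parity-sumFin (λ a → count (inv τ a)) ⟩
    ∑[ a < n ] parity (count (inv τ a))
      ≡⟨ sum-cong-≗ (λ a → parity-count (inv τ a)) ⟩
    ∑[ a < n ] ∑[ b < n ] inv τ a b
      ≡⟨ sum-cong-≗ (λ a → sum-cong-≗ (λ b → inv-as-sum a b)) ⟩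
    ∑[ a < n ] ∑[ b < n ] ∑[ c < n ] ∑[ d < n ] (edges τ a c ∧ edges τ b d ∧ a <ᵇ b ∧ d <ᵇ c)
      ≡⟨ sum-cong-≗ (λ a → ∑-comm (λ b c → ∑[ d < n ] (edges τ a c ∧ edges τ b d ∧ a <ᵇ b ∧ d <ᵇ c))) ⟩
    crossings (edges τ) (edges τ) ∎
    where
    open ≡-Reasoning
    inv-as-sum : ∀ a b → inv τ a b ≡ ∑[ c < n ] ∑[ d < n ] (edges τ a c ∧ edges τ b d ∧ a <ᵇ b ∧ d <ᵇ c)
    inv-as-sum a b = sym (begin
      ∑[ c < n ] ∑[ d < n ] (edges τ a c ∧ edges τ b d ∧ a <ᵇ b ∧ d <ᵇ c)
        ≡⟨ sum-cong-≗ (λ c → *-distribˡ-sum (edges τ a c) (λ d → edges τ b d ∧ a <ᵇ b ∧ d <ᵇ c)) ⟨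
      ∑[ c < n ] (edges τ a c ∧ ∑[ d < n ] (edges τ b d ∧ a <ᵇ b ∧ d <ᵇ c))
        ≡⟨ sum-cong-≗ (λ c → cong (edges τ a c ∧_) (sum-edges τ b (λ d → a <ᵇ b ∧ d <ᵇ c))) ⟩
      ∑[ c < n ] (edges τ a c ∧ maybe′ (λ d → a <ᵇ b ∧ d <ᵇ c) false (τ b))
        ≡⟨ sum-edges τ a (λ c → maybe′ (λ d → a <ᵇ b ∧ d <ᵇ c) false (τ b)) ⟩
      maybe′ (λ c → maybe′ (λ d → a <ᵇ b ∧ d <ᵇ c) false (τ b)) false (τ a)
        ≡⟨ by-cases ⟩
      inv τ a b ∎)
      where
      by-cases : maybe′ (λ c → maybe′ (λ d → a <ᵇ b ∧ d <ᵇ c) false (τ b)) false (τ a) ≡ inv τ a b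
      by-cases with τ a | τ b
      ... | just _  | just _  = refl
      ... | just _  | nothing = refl
      ... | nothing | just _  = refl
      ... | nothing | nothing = refl

  module _ (τ : PMap n) where

    count-out : ∀ a → count (edges τ a) ≡ 𝟙 (dom τ a)
    count-out a = at (τ a) refl
      where
      at : ∀ m → τ a ≡ m → count (edges τ a) ≡ 𝟙 (is-just m)
      at nothing  τa = trans (count-cong (λ c → edges-nothing τ a c τa)) (count-false {n})
      at (just b) τa = trans (count-singleton (edges τ a) b (λ c → edges-other τ a c τa)) (cong 𝟙 (edges-just τ a b τa))

    count-in : PInjective τ → ∀ c → count (λ a → edges τ a c) ≡ 𝟙 (ran τ c)
    count-in inj c with InRan? τ c
    ... | yes (a , τa) = trans (count-singleton (λ x → edges τ x c) a off) (cong 𝟙 (edges-just τ a c τa))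
      where
      off : ∀ x → x ≢ a → edges τ x c ≡ false
      off x x≢a = edges-false τ x c λ τx → x≢a (inj x a c τx τa)
    ... | no ¬ran = trans (count-cong (λ x → edges-false τ x c λ τx → ¬ran (x , τx))) (count-false {n})

    outdeg-edges : ∀ a → outdeg (edges τ) a ≡ dom τ a
    outdeg-edges a = trans (sym (parity-count (edges τ a))) (trans (cong parity (count-out a)) (parity-𝟙 _))

    indeg-edges : PInjective τ → ∀ c → indeg (edges τ) c ≡ ran τ c
    indeg-edges inj c = trans (sym (parity-count (λ a → edges τ a c))) (trans (cong parity (count-in inj c)) (parity-𝟙 _))

    -- double counting the edges inside χ
    count-closed : PInjective τ → ∀ {χ} → Closed χ (edges τ) →
                   count (λ x → χ x ∧ dom τ x) ≡ count (λ x → χ x ∧ ran τ x)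
    count-closed inj {χ} closed = begin
      count (λ x → χ x ∧ dom τ x)
        ≡⟨ count-sum (λ x → χ x ∧ dom τ x) ⟩
      ℕ∑.sum (λ x → 𝟙 (χ x ∧ dom τ x))
        ≡⟨ ℕ∑.sum-cong-≗ (λ x → trans (sym (row x)) (count-sum (λ c → χ x ∧ edges τ x c))) ⟩
      ℕ∑.sum (λ x → ℕ∑.sum (λ c → 𝟙 (χ x ∧ edges τ x c)))
        ≡⟨ ℕ∑.∑-comm (λ x c → 𝟙 (χ x ∧ edges τ x c)) ⟩
      ℕ∑.sum (λ c → ℕ∑.sum (λ x → 𝟙 (χ x ∧ edges τ x c)))
        ≡⟨ ℕ∑.sum-cong-≗ (λ c → ℕ∑.sum-cong-≗ (λ x → cong 𝟙 (closed-∧ closed x c))) ⟩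
      ℕ∑.sum (λ c → ℕ∑.sum (λ x → 𝟙 (χ c ∧ edges τ x c)))
        ≡⟨ ℕ∑.sum-cong-≗ (λ c → trans (sym (count-sum (λ x → χ c ∧ edges τ x c))) (column c)) ⟩
      ℕ∑.sum (λ c → 𝟙 (χ c ∧ ran τ c))
        ≡⟨ count-sum (λ x → χ x ∧ ran τ x) ⟨
      count (λ x → χ x ∧ ran τ x) ∎
      where
      open ≡-Reasoning
      row : ∀ x → count (λ c → χ x ∧ edges τ x c) ≡ 𝟙 (χ x ∧ dom τ x)
      row x with χ x
      ... | true  = count-out x
      ... | false = count-false {n}
      column : ∀ c → count (λ x → χ c ∧ edges τ x c) ≡ 𝟙 (χ c ∧ ran τ c)
      column c with χ c
      ... | true  = count-in inj c
      ... | false = count-false {n}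

-- Flips reverse a union of components

module _ {n : ℕ} {τ : PMap n} where

  conn-sym : ∀ {x y} → Conn τ x y → Conn τ y x
  conn-sym = Star.reverse adj-sym
    where
    adj-sym : ∀ {x y} → Adj τ x y → Adj τ y x
    adj-sym (inj₁ τx) = inj₂ τx
    adj-sym (inj₂ τy) = inj₁ τy

  component-of-2-cycle : PInjective τ → ∀ {x y} → τ x ≡ just y → τ y ≡ just x →
                         ∀ {z w} → z ≡ x ⊎ z ≡ y → Conn τ z w → w ≡ x ⊎ w ≡ y
  component-of-2-cycle inj τx τy z∈ Star.ε = z∈
  component-of-2-cycle inj τx τy (inj₁ refl) (inj₁ τz ◅ rest) =
    component-of-2-cycle inj τx τy (inj₂ (just-injective (trans (sym τz) τx))) rest
  component-of-2-cycle inj τx τy (inj₂ refl) (inj₁ τz ◅ rest) =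
    component-of-2-cycle inj τx τy (inj₁ (just-injective (trans (sym τz) τy))) rest
  component-of-2-cycle inj τx τy (inj₁ refl) (inj₂ τz ◅ rest) = component-of-2-cycle inj τx τy (inj₂ (inj _ _ _ τz τy)) rest
  component-of-2-cycle inj τx τy (inj₂ refl) (inj₂ τz ◅ rest) = component-of-2-cycle inj τx τy (inj₁ (inj _ _ _ τz τx)) rest

  component-of-isolated : ∀ {x} → τ x ≡ nothing → (∀ y → τ y ≢ just x) → ∀ {w} → Conn τ x w → w ≡ x
  component-of-isolated τx ¬in Star.ε = refl
  component-of-isolated τx ¬in (inj₁ τx′ ◅ _) = ⊥-elim (nothing≢just (trans (sym τx) τx′))
  component-of-isolated τx ¬in (inj₂ τy ◅ _) = ⊥-elim (¬in _ τy)

  module _ {i j : Fin n} {τ′ : PMap n} (inj : PInjective τ) (open-cluster : HasOpenClusterWith τ i j)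
           (flipped : ∀ x → (Conn τ i x → ∀ y → (τ′ x ≡ just y ⇔ τ y ≡ just x)) × (¬ Conn τ i x → τ′ x ≡ τ x)) where

    private
      both-ways : ∀ {x y} → τ x ≡ just y → τ y ≡ just x → ¬ Deg1 τ x
      both-ways τx τy (inj₁ (_ , ¬ran)) = ¬ran (_ , τy)
      both-ways τx τy (inj₂ (¬dom , _)) = ¬dom (_ , τx)

      -- the open cluster through i is neither a 2-cycle nor an isolated vertex
      moved : ∀ {x} → Conn τ i x → τ′ x ≢ τ x
      moved {x} cx same = at (τ x) refl
        where
        at : ∀ m → τ x ≡ m → ⊥
        at (just y) τx = not-open (proj₂ open-cluster)
          where
          τy : τ y ≡ just x
          τy = Equivalence.to (proj₁ (flipped x) cx y) (trans same τx)
          not-open : ¬ OpenAt τ i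
          not-open (z , cz , deg1) with component-of-2-cycle inj τx τy (inj₁ refl) (conn-sym cx ◅◅ cz)
          ... | inj₁ refl = both-ways τx τy deg1
          ... | inj₂ refl = both-ways τy τx deg1
        at nothing τx = no-edge-at-i (proj₁ open-cluster)
          where
          ¬in : ∀ y → τ y ≢ just x
          ¬in y τy = nothing≢just (trans (sym τx) (trans (sym same) (Equivalence.from (proj₁ (flipped x) cx y) τy)))
          i≡x : i ≡ x
          i≡x = component-of-isolated τx ¬in (conn-sym cx)
          no-edge-at-i : ¬ (τ i ≡ just j ⊎ τ j ≡ just i)
          no-edge-at-i (inj₁ τi) = nothing≢just (trans (sym τx) (trans (cong τ (sym i≡x)) τi))
          no-edge-at-i (inj₂ τj) = ¬in j (trans τj (cong just i≡x))

      -- the moved vertices: a decidable description of the component of i (part-true, part-true⁻¹)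
      part : Fin n → Bool
      part x = not (does (τ′ x ≟ₘ τ x))

      part-true : ∀ {x} → Conn τ i x → part x ≡ true
      part-true {x} cx = cong not (dec-false (τ′ x ≟ₘ τ x) (moved cx))

      part-true⁻¹ : ∀ {x} → part x ≡ true → ¬ ¬ Conn τ i x
      part-true⁻¹ {x} px ¬cx = true-false-≢ px (cong not (dec-true (τ′ x ≟ₘ τ x) (proj₂ (flipped x) ¬cx))) refl

      unmoved : ∀ x → part x ≡ false → τ′ x ≡ τ x
      unmoved x px with τ′ x ≟ₘ τ x
      unmoved x px  | yes same = same
      unmoved x () | no _

    open-flip-reversal : Reversal (edges τ) (edges τ′)
    open-flip-reversal = record { part = part ; closed = closed ; reversed = reversed }
      where
      closed : Closed part (edges τ)
      closed a c eac with part a in pa | part c in pc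
      ... | true  | true  = refl
      ... | false | false = refl
      ... | true  | false = ⊥-elim (part-true⁻¹ pa λ ca →
                              true-false-≢ (part-true (ca ◅◅ (inj₁ (edges-true τ a c eac) ◅ Star.ε))) pc refl)
      ... | false | true  = ⊥-elim (part-true⁻¹ pc λ cc →
                              true-false-≢ (part-true (cc ◅◅ (inj₂ (edges-true τ a c eac) ◅ Star.ε))) pa refl)
      reversed : ∀ a c → edges τ′ a c ≡ (if part a then edges τ c a else edges τ a c)
      reversed a c with part a in pa
      ... | true  = decidable-stable (edges τ′ a c Bool.≟ edges τ c a) λ ne →
                      part-true⁻¹ pa λ ca → ne (does-⇔ (proj₁ (flipped a) ca c) (τ′ a ≟ₘ just c) (τ c ≟ₘ just a))
      ... | false = cong (λ m → does (m ≟ₘ just c)) (unmoved a pa)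

  flip-reversal : ∀ {i j τ′} → PInjective τ → Flip i j τ τ′ → Reversal (edges τ) (edges τ′)
  flip-reversal inj (inj₁ (open-cluster , flipped)) = open-flip-reversal inj open-cluster flipped
  flip-reversal inj (inj₂ (_ , same)) = record
    { part = λ _ → false ; closed = λ _ _ _ → refl ; reversed = λ a c → cong (λ m → does (m ≟ₘ just c)) (same a) }

-- Interlacing matchings

module _ {n : ℕ} where

  below : ℕ → Fin n → Bool
  below m x = ⌊ toℕ x ℕ.<? m ⌋

  countBelow : ℕ → List (Fin n) → ℕ
  countBelow m []       = 0
  countBelow m (x ∷ xs) = 𝟙 (below m x) + countBelow m xs

  below-true : ∀ {m} x → toℕ x < m → below m x ≡ true
  below-true {m} x x<m with toℕ x ℕ.<? m
  ... | yes _   = refl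
  ... | no x≮m = ⊥-elim (x≮m x<m)

  below-false : ∀ {m} x → m ≤ toℕ x → below m x ≡ false
  below-false {m} x m≤x with toℕ x ℕ.<? m
  ... | yes x<m = ⊥-elim (ℕ.<⇒≱ x<m m≤x)
  ... | no _    = refl

  countBelow-beyond : ∀ {b} is js → AtMostHead b is → Interlaces is js →
                      ∀ m → m ≤ toℕ b → countBelow m is ≡ 0 × countBelow m js ≡ 0
  countBelow-beyond []       []       _   _                   m m≤b = refl , refl
  countBelow-beyond (i ∷ is) (j ∷ js) b≤i (i≤j , j≤is , rest) m m≤b
    with countBelow-beyond is js j≤is rest m (ℕ.≤-trans m≤b (ℕ.≤-trans b≤i i≤j))
  ... | is₀ , js₀ = cong₂ _+_ (cong 𝟙 (below-false i (ℕ.≤-trans m≤b b≤i))) is₀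
                  , cong₂ _+_ (cong 𝟙 (below-false j (ℕ.≤-trans m≤b (ℕ.≤-trans b≤i i≤j)))) js₀

  interlaces-countBelow : ∀ is js → Interlaces is js → ∀ m →
                          countBelow m js ≤ countBelow m is × countBelow m is ≤ suc (countBelow m js)
  interlaces-countBelow []       []       _                   m = z≤n , z≤n
  interlaces-countBelow (i ∷ is) (j ∷ js) (i≤j , j≤is , rest) m with toℕ j ℕ.<? m | toℕ i ℕ.<? m
  ... | yes j<m | yes i<m with interlaces-countBelow is js rest m
  ...   | js≤is , is≤js+1 = s≤s js≤is , s≤s is≤js+1
  interlaces-countBelow (i ∷ is) (j ∷ js) (i≤j , j≤is , rest) m | yes j<m | no i≮m = ⊥-elim (i≮m (ℕ.≤-<-trans i≤j j<m))
  interlaces-countBelow (i ∷ is) (j ∷ js) (i≤j , j≤is , rest) m | no j≮m | yes _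
    with countBelow-beyond is js j≤is rest m (ℕ.≮⇒≥ j≮m)
  ...   | is₀ , js₀ rewrite is₀ | js₀ = z≤n , s≤s z≤n
  interlaces-countBelow (i ∷ is) (j ∷ js) (i≤j , j≤is , rest) m | no j≮m | no _
    with countBelow-beyond is js j≤is rest m (ℕ.≮⇒≥ j≮m)
  ...   | is₀ , js₀ rewrite is₀ | js₀ = z≤n , z≤n

  countBelow-filter : ∀ {k} {P : Fin n → Set} (P? : ∀ x → Dec (P x)) (f : Fin k → Fin n) m →
    countBelow m (filter P? (tabulate f)) ≡ count (λ x → does (P? (f x)) ∧ below m (f x))
  countBelow-filter {zero}  P? f m = refl
  countBelow-filter {suc k} P? f m with P? (f zero)
  ... | yes _ = cong (𝟙 (below m (f zero)) +_) (countBelow-filter P? (f ∘ suc) m)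
  ... | no _  = countBelow-filter P? (f ∘ suc) m

  count-below-suc : ∀ (p : Fin n → Bool) w →
    count (λ x → p x ∧ below (suc (toℕ w)) x) ≡ count (λ x → p x ∧ below (toℕ w) x) + 𝟙 (p w)
  count-below-suc p w = trans (count-split split) (cong (count (λ x → p x ∧ below (toℕ w) x) +_) at-w)
    where
    split : ∀ x → 𝟙 (p x ∧ below (suc (toℕ w)) x) ≡ 𝟙 (p x ∧ below (toℕ w) x) + 𝟙 (p x ∧ does (x ≟ w))
    split x with p x | <-cmp x w
    ... | false | _ = refl
    ... | true | tri< x<w x≢w _ rewrite below-true x (ℕ.m<n⇒m<1+n x<w) | below-true x x<w | dec-false (x ≟ w) x≢w = refl
    ... | true | tri≈ _ refl _ rewrite below-true x (ℕ.n<1+n (toℕ x)) | below-false x (ℕ.≤-refl {toℕ x}) | dec-true (x ≟ x) refl = refl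
    ... | true | tri> _ x≢w w<x rewrite below-false x w<x | below-false x (ℕ.<⇒≤ w<x) | dec-false (x ≟ w) x≢w = refl
    at-w : count (λ x → p x ∧ does (x ≟ w)) ≡ 𝟙 (p w)
    at-w = trans (count-singleton (λ x → p x ∧ does (x ≟ w)) w
                                  (λ y y≢w → trans (cong (p y ∧_) (dec-false (y ≟ w) y≢w)) (∧-zeroʳ (p y))))
                 (cong 𝟙 (trans (cong (p w ∧_) (dec-true (w ≟ w) refl)) (∧-identityʳ (p w))))

module _ {n : ℕ} (τ : PMap n) (interlacing : Interlaces (domList τ) (ranList τ)) where

  private
    D R : ℕ → ℕ
    D m = count (λ x → dom τ x ∧ below m x)
    R m = count (λ x → ran τ x ∧ below m x)

    balance : ∀ m → R m ≤ D m × D m ≤ suc (R m)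
    balance m = subst₂ (λ d r → r ≤ d × d ≤ suc r)
                       (countBelow-filter (λ x → T? (is-just (τ x))) id m) (countBelow-filter (InRan? τ) id m)
                       (interlaces-countBelow (domList τ) (ranList τ) interlacing m)

  symdiff-below : ∀ w → dom τ w xor ran τ w ≡ true → ∑[ x < n ] (x <ᵇ w ∧ (dom τ x xor ran τ x)) ≡ ran τ w
  symdiff-below w δw = begin
    ∑[ x < n ] (x <ᵇ w ∧ (dom τ x xor ran τ x))
      ≡⟨ sum-cong-≗ (λ x → distrib (x <ᵇ w) (dom τ x) (ran τ x)) ⟩
    ∑[ x < n ] ((dom τ x ∧ below t x) xor (ran τ x ∧ below t x))
      ≡⟨ ∑-distrib-+ (λ x → dom τ x ∧ below t x) (λ x → ran τ x ∧ below t x) ⟩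
    sum (λ x → dom τ x ∧ below t x) xor sum (λ x → ran τ x ∧ below t x)
      ≡⟨ cong₂ _xor_ (parity-count (λ x → dom τ x ∧ below t x)) (parity-count (λ x → ran τ x ∧ below t x)) ⟨
    parity (D t) xor parity (R t)
      ≡⟨ by-cases (dom τ w) (ran τ w) refl refl δw ⟩
    ran τ w ∎
    where
    open ≡-Reasoning
    t = toℕ w
    distrib : ∀ l d r → l ∧ (d xor r) ≡ (d ∧ l) xor (r ∧ l)
    distrib = solve-∀ 𝔽₂
    D-suc : D (suc t) ≡ D t + 𝟙 (dom τ w)
    D-suc = count-below-suc (dom τ) w
    R-suc : R (suc t) ≡ R t + 𝟙 (ran τ w)
    R-suc = count-below-suc (ran τ) w
    by-cases : ∀ d r → dom τ w ≡ d → ran τ w ≡ r → d xor r ≡ true → parity (D t) xor parity (R t) ≡ r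
    by-cases true false dw rw _ = trans (cong (λ d → parity d xor parity (R t)) D≡R) (xor-same (parity (R t)))
      where
      D≤R : D t ≤ R t
      D≤R = ℕ.+-cancelʳ-≤ 1 (D t) (R t) (subst₂ _≤_ (trans D-suc (cong (λ d → D t + 𝟙 d) dw))
                                                  (trans (cong suc (trans R-suc (trans (cong (λ r → R t + 𝟙 r) rw) (ℕ.+-identityʳ (R t)))))
                                                         (ℕ.+-comm 1 (R t)))
                                                  (proj₂ (balance (suc t))))
      D≡R : D t ≡ R t
      D≡R = ℕ.≤-antisym D≤R (proj₁ (balance t))
    by-cases false true dw rw _ = trans (cong (λ d → parity d xor parity (R t)) D≡1+R) (xor-inverseˡ (parity (R t)))
      where
      1+R≤D : suc (R t) ≤ D t
      1+R≤D = subst₂ _≤_ (trans R-suc (trans (cong (λ r → R t + 𝟙 r) rw) (ℕ.+-comm (R t) 1)))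
                         (trans D-suc (trans (cong (λ d → D t + 𝟙 d) dw) (ℕ.+-identityʳ (D t))))
                         (proj₁ (balance (suc t)))
      D≡1+R : D t ≡ suc (R t)
      D≡1+R = ℕ.≤-antisym (proj₂ (balance t)) 1+R≤D

-- The correction term vanishes for interlacing matchings

module _ {n : ℕ} where

  sum-split-around : ∀ (f : Fin n → Bool) w → sum f ≡ ∑[ x < n ] (x <ᵇ w ∧ f x) xor f w xor ∑[ x < n ] (w <ᵇ x ∧ f x)
  sum-split-around f w = begin
    sum f
      ≡⟨ sum-cong-≗ split ⟩
    ∑[ x < n ] ((x <ᵇ w ∧ f x) xor (does (x ≟ w) ∧ f x) xor (w <ᵇ x ∧ f x))
      ≡⟨ ∑-distrib-+ (λ x → x <ᵇ w ∧ f x) _ ⟩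
    ∑[ x < n ] (x <ᵇ w ∧ f x) xor ∑[ x < n ] ((does (x ≟ w) ∧ f x) xor (w <ᵇ x ∧ f x))
      ≡⟨ cong (∑[ x < n ] (x <ᵇ w ∧ f x) xor_) (∑-distrib-+ (λ x → does (x ≟ w) ∧ f x) (λ x → w <ᵇ x ∧ f x)) ⟩
    ∑[ x < n ] (x <ᵇ w ∧ f x) xor ∑[ x < n ] (does (x ≟ w) ∧ f x) xor ∑[ x < n ] (w <ᵇ x ∧ f x)
      ≡⟨ cong (λ y → ∑[ x < n ] (x <ᵇ w ∧ f x) xor y xor ∑[ x < n ] (w <ᵇ x ∧ f x)) at-w ⟩
    ∑[ x < n ] (x <ᵇ w ∧ f x) xor f w xor ∑[ x < n ] (w <ᵇ x ∧ f x) ∎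
    where
    open ≡-Reasoning
    split : ∀ x → f x ≡ (x <ᵇ w ∧ f x) xor (does (x ≟ w) ∧ f x) xor (w <ᵇ x ∧ f x)
    split x with <-cmp x w
    ... | tri< x<w x≢w _ rewrite below-true x x<w | dec-false (x ≟ w) x≢w | below-false w (ℕ.<⇒≤ x<w) =
      sym (xor-identityʳ (f x))
    ... | tri≈ _ refl _ rewrite below-false x (ℕ.≤-refl {toℕ x}) | dec-true (x ≟ x) refl = sym (xor-identityʳ (f x))
    ... | tri> _ x≢w w<x rewrite below-false x (ℕ.<⇒≤ w<x) | dec-false (x ≟ w) x≢w | below-true w w<x = refl
    at-w : ∑[ x < n ] (does (x ≟ w) ∧ f x) ≡ f w
    at-w = trans (sum-singleton +-monoid (λ x → does (x ≟ w) ∧ f x) w (λ y y≢w → cong (_∧ f y) (dec-false (y ≟ w) y≢w)))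
                 (cong (_∧ f w) (dec-true (w ≟ w) refl))

<ᵇ-suc : ∀ {n} (a b : Fin n) → suc a <ᵇ suc b ≡ a <ᵇ b
<ᵇ-suc a b with a <? b | suc a <? suc b
... | yes _   | yes _   = refl
... | yes a<b | no a≮b  = ⊥-elim (a≮b (s≤s a<b))
... | no a≮b  | yes a<b = ⊥-elim (a≮b (s≤s⁻¹ a<b))
... | no _    | no _    = refl

parity-C2-suc : ∀ m → parity (suc m C 2) ≡ parity m xor parity (m C 2)
parity-C2-suc m = trans (cong parity (sym (trans (cong (_+ m C 2) (sym (nC1≡n m))) (nCk+nC[k+1]≡[n+1]C[k+1] m 1))))
                        (parity-+ m (m C 2))

parity-C2-double : ∀ a → parity ((a + a) C 2) ≡ parity a
parity-C2-double zero    = refl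
parity-C2-double (suc a) rewrite ℕ.+-suc a a = begin
  parity (suc (suc s) C 2)                         ≡⟨ parity-C2-suc (suc s) ⟩
  parity (suc s) xor parity (suc s C 2)            ≡⟨ cong (parity (suc s) xor_) (parity-C2-suc s) ⟩
  parity (suc s) xor (parity s xor parity (s C 2)) ≡⟨ cong (λ c → parity (suc s) xor (parity s xor c)) (parity-C2-double a) ⟩
  (true xor parity s) xor (parity s xor parity a)  ≡⟨ cancel (parity s) (parity a) ⟩
  true xor parity a                                ∎
  where
  open ≡-Reasoning
  s = a + a
  cancel : ∀ p c → (true xor p) xor (p xor c) ≡ true xor c
  cancel = solve-∀ 𝔽₂

pairs-parity : ∀ {n} (g : Fin n → Bool) → ∑² (λ w x → g w ∧ w <ᵇ x ∧ g x) ≡ parity (count g C 2)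
pairs-parity {zero}  g = refl
pairs-parity {suc n} g = trans (cong₂ _xor_ row₀ rows) (combine (g zero))
  where
  K = count (g ∘ suc)
  row₀ : ∑[ x < suc n ] (g zero ∧ zero <ᵇ x ∧ g x) ≡ g zero ∧ parity K
  row₀ = trans (cong (_xor ∑[ x < n ] (g zero ∧ g (suc x))) (∧-zeroʳ (g zero)))
               (trans (sym (*-distribˡ-sum (g zero) (g ∘ suc))) (cong (g zero ∧_) (sym (parity-count (g ∘ suc)))))
  rows : ∑[ w < n ] ∑[ x < suc n ] (g (suc w) ∧ suc w <ᵇ x ∧ g x) ≡ parity (K C 2)
  rows = trans (sum-cong-≗ (λ w → cong₂ _xor_ (∧-zeroʳ (g (suc w)))
                                     (sum-cong-≗ (λ x → cong (λ l → g (suc w) ∧ l ∧ g (suc x)) (<ᵇ-suc w x)))))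
               (pairs-parity (g ∘ suc))
  combine : ∀ b → (b ∧ parity K) xor parity (K C 2) ≡ parity ((𝟙 b + K) C 2)
  combine true  = sym (parity-C2-suc K)
  combine false = refl

module _ {n : ℕ} where

  count-∧-not : ∀ (p q : Fin n → Bool) → count p ≡ count (λ x → p x ∧ q x) + count (λ x → p x ∧ not (q x))
  count-∧-not p q = count-split (λ x → split (p x) (q x))
    where
    split : ∀ a b → 𝟙 a ≡ 𝟙 (a ∧ b) + 𝟙 (a ∧ not b)
    split true  true  = refl
    split true  false = refl
    split false _     = refl

  count-xor : ∀ (p q : Fin n → Bool) →
              count (λ x → p x xor q x) ≡ count (λ x → p x ∧ not (q x)) + count (λ x → q x ∧ not (p x))
  count-xor p q = count-split (λ x → split (p x) (q x))
    where
    split : ∀ a b → 𝟙 (a xor b) ≡ 𝟙 (a ∧ not b) + 𝟙 (b ∧ not a)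
    split true  true  = refl
    split true  false = refl
    split false true  = refl
    split false false = refl

  count-difference : ∀ {p q : Fin n → Bool} → count p ≡ count q →
                     count (λ x → p x ∧ not (q x)) ≡ count (λ x → q x ∧ not (p x))
  count-difference {p} {q} p≡q = ℕ.+-cancelˡ-≡ (count (λ x → p x ∧ q x)) _ _ (begin
    count (λ x → p x ∧ q x) + count (λ x → p x ∧ not (q x)) ≡⟨ count-∧-not p q ⟨
    count p                                                 ≡⟨ p≡q ⟩
    count q                                                 ≡⟨ count-∧-not q p ⟩
    count (λ x → q x ∧ p x) + count (λ x → q x ∧ not (p x))
      ≡⟨ cong (_+ count (λ x → q x ∧ not (p x))) (count-cong (λ x → ∧-comm (q x) (p x))) ⟩
    count (λ x → p x ∧ q x) + count (λ x → q x ∧ not (p x)) ∎)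
    where open ≡-Reasoning

  module _ (dom ran χ : Fin n → Bool)
           (symdiff-below : ∀ w → dom w xor ran w ≡ true → ∑[ x < n ] (x <ᵇ w ∧ (dom x xor ran x)) ≡ ran w)
           (balanced : sum dom ≡ sum ran)
           (χ-balanced : count (λ x → χ x ∧ dom x) ≡ count (λ x → χ x ∧ ran x)) where

    private
      δ g : Fin n → Bool
      δ x = dom x xor ran x
      g x = χ x ∧ δ x

      symdiff-above : ∀ w → δ w ≡ true → ∑[ x < n ] (w <ᵇ x ∧ δ x) ≡ dom w
      symdiff-above w δw = begin
        A                                ≡⟨ isolate B (δ w) A ⟩
        (B xor δ w xor A) xor (B xor δ w) ≡⟨ cong (_xor (B xor δ w)) (trans (sym (sum-split-around δ w)) sum-δ) ⟩
        B xor δ w                        ≡⟨ cong (_xor δ w) (symdiff-below w δw) ⟩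
        ran w xor (dom w xor ran w)      ≡⟨ cancel (dom w) (ran w) ⟩
        dom w                            ∎
        where
        open ≡-Reasoning
        A = ∑[ x < n ] (w <ᵇ x ∧ δ x)
        B = ∑[ x < n ] (x <ᵇ w ∧ δ x)
        sum-δ : sum δ ≡ false
        sum-δ = trans (∑-distrib-+ dom ran) (trans (cong (_xor sum ran) balanced) (xor-same (sum ran)))
        isolate : ∀ b d a → a ≡ (b xor d xor a) xor (b xor d)
        isolate = solve-∀ 𝔽₂
        cancel : ∀ d r → r xor (d xor r) ≡ d
        cancel = solve-∀ 𝔽₂

      a : ℕ
      a = count (λ x → (χ x ∧ dom x) ∧ not (χ x ∧ ran x))

      towards-δ : ∑² (λ w x → g w ∧ w <ᵇ x ∧ δ x) ≡ parity a
      towards-δ = begin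
        ∑² (λ w x → g w ∧ w <ᵇ x ∧ δ x)      ≡⟨ sum-cong-≗ (λ w → *-distribˡ-sum (g w) (λ x → w <ᵇ x ∧ δ x)) ⟨
        ∑[ w < n ] (g w ∧ ∑[ x < n ] (w <ᵇ x ∧ δ x)) ≡⟨ sum-cong-≗ row ⟩
        ∑[ w < n ] (g w ∧ dom w)             ≡⟨ sum-cong-≗ (λ w → exclusive (χ w) (dom w) (ran w)) ⟩
        ∑[ w < n ] ((χ w ∧ dom w) ∧ not (χ w ∧ ran w)) ≡⟨ parity-count (λ w → (χ w ∧ dom w) ∧ not (χ w ∧ ran w)) ⟨
        parity a                             ∎
        where
        open ≡-Reasoning
        row : ∀ w → (χ w ∧ δ w) ∧ ∑[ x < n ] (w <ᵇ x ∧ δ x) ≡ (χ w ∧ δ w) ∧ dom w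
        row w with δ w in δw
        ... | true  = cong ((χ w ∧ true) ∧_) (symdiff-above w δw)
        ... | false = trans (cong (_∧ _) (∧-zeroʳ (χ w))) (sym (cong (_∧ dom w) (∧-zeroʳ (χ w))))
        exclusive : ∀ c d r → (c ∧ (d xor r)) ∧ d ≡ (c ∧ d) ∧ not (c ∧ r)
        exclusive true  true  r = ∧-identityʳ (not r)
        exclusive true  false r = ∧-zeroʳ r
        exclusive false d     r = refl

      within-χ : ∑² (λ w x → g w ∧ w <ᵇ x ∧ g x) ≡ parity a
      within-χ = begin
        ∑² (λ w x → g w ∧ w <ᵇ x ∧ g x) ≡⟨ pairs-parity g ⟩
        parity (count g C 2)          ≡⟨ cong (λ m → parity (m C 2)) count-g ⟩
        parity ((a + a) C 2)          ≡⟨ parity-C2-double a ⟩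
        parity a                      ∎
        where
        open ≡-Reasoning
        count-g : count g ≡ a + a
        count-g = begin
          count g                                            ≡⟨ count-cong (λ x → ∧-distribˡ-xor (χ x) (dom x) (ran x)) ⟩
          count (λ x → (χ x ∧ dom x) xor (χ x ∧ ran x))     ≡⟨ count-xor (λ x → χ x ∧ dom x) (λ x → χ x ∧ ran x) ⟩
          a + count (λ x → (χ x ∧ ran x) ∧ not (χ x ∧ dom x)) ≡⟨ cong (a +_) (count-difference χ-balanced) ⟨
          a + a                                              ∎

    cross-term-vanishes :
      ∑² (λ w x → (χ w ∧ (dom w xor ran w)) ∧ (not (χ x) ∧ (dom x xor ran x)) ∧ w <ᵇ x) ≡ false
    cross-term-vanishes = begin
      ∑² (λ w x → (χ w ∧ δ w) ∧ (not (χ x) ∧ δ x) ∧ w <ᵇ x)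
        ≡⟨ ∑²-cong (λ w x → split (g w) (χ x) (δ x) (w <ᵇ x)) ⟩
      ∑² (λ w x → (g w ∧ w <ᵇ x ∧ δ x) xor (g w ∧ w <ᵇ x ∧ g x))
        ≡⟨ ∑²-distrib-xor (λ w x → g w ∧ w <ᵇ x ∧ δ x) (λ w x → g w ∧ w <ᵇ x ∧ g x) ⟩
      ∑² (λ w x → g w ∧ w <ᵇ x ∧ δ x) xor ∑² (λ w x → g w ∧ w <ᵇ x ∧ g x)
        ≡⟨ cong₂ _xor_ towards-δ within-χ ⟩
      parity a xor parity a
        ≡⟨ xor-same (parity a) ⟩
      false ∎
      where
      open ≡-Reasoning
      split : ∀ G c d l → G ∧ ((true xor c) ∧ d) ∧ l ≡ (G ∧ l ∧ d) xor (G ∧ l ∧ (c ∧ d))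
      split = solve-∀ 𝔽₂

-- Invariance along an orbit

module _ {n : ℕ} where

  SameUndirected : Digraph n → Digraph n → Set
  SameUndirected e e′ = (∀ x y → (e x y ∨ e y x) ≡ (e′ x y ∨ e′ y x)) × (∀ w → deg e w ≡ deg e′ w)

  module _ (τ₀ : PMap n) (inj₀ : PInjective τ₀) (interlacing : Interlaces (domList τ₀) (ranList τ₀)) where

    private
      e₀ = edges τ₀

    reversal-preserves-crossings : ∀ {e e′} → Reversal e e′ → SameUndirected e e₀ → crossings e′ e′ ≡ crossings e e
    reversal-preserves-crossings {e} {e′} r (same-adj , same-deg) = begin
      crossings e′ e′
        ≡⟨ reversal-crossings r ⟩
      crossings e e xor ∑² (λ w x → (part w ∧ deg e w) ∧ (not (part x) ∧ deg e x) ∧ w <ᵇ x)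
        ≡⟨ cong (crossings e e xor_) correction ⟩
      crossings e e xor false
        ≡⟨ xor-identityʳ (crossings e e) ⟩
      crossings e e ∎
      where
      open ≡-Reasoning
      open Reversal r
      deg₀ : ∀ w → deg e w ≡ dom τ₀ w xor ran τ₀ w
      deg₀ w = trans (same-deg w) (cong₂ _xor_ (outdeg-edges τ₀ w) (indeg-edges τ₀ inj₀ w))
      balanced : sum (dom τ₀) ≡ sum (ran τ₀)
      balanced = trans (sym (parity-count (dom τ₀)))
                       (trans (cong parity (count-closed τ₀ inj₀ {λ _ → true} (λ _ _ _ → refl))) (parity-count (ran τ₀)))
      closed₀ : Closed part e₀
      closed₀ a c e₀ac = by-cases (e a c) (e c a) refl refl
        where
        adjacent : (e a c ∨ e c a) ≡ true
        adjacent = trans (same-adj a c) (cong (_∨ e₀ c a) e₀ac)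
        by-cases : ∀ p q → e a c ≡ p → e c a ≡ q → part a ≡ part c
        by-cases true  _     eac _   = closed a c eac
        by-cases false true  _   eca = sym (closed c a eca)
        by-cases false false eac eca = ⊥-elim (true-false-≢ adjacent (cong₂ _∨_ eac eca) refl)
      correction : ∑² (λ w x → (part w ∧ deg e w) ∧ (not (part x) ∧ deg e x) ∧ w <ᵇ x) ≡ false
      correction = trans (∑²-cong (λ w x → cong₂ (λ p q → (part w ∧ p) ∧ (not (part x) ∧ q) ∧ w <ᵇ x) (deg₀ w) (deg₀ x)))
                         (cross-term-vanishes (dom τ₀) (ran τ₀) part (symdiff-below τ₀ interlacing)
                                              balanced (count-closed τ₀ inj₀ closed₀))

module _ {n k : ℕ} (m₀ : Matching n k) (interlacing : Interlacing m₀) where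

  Invariant : Matching n k → Set
  Invariant m = SameUndirected (edges (τ m)) (edges (τ m₀)) × parity (inversions (τ m)) ≡ parity (inversions (τ m₀))

  step-reversal : ∀ {a b : Matching n k} → SymClosure Step a b → Reversal (edges (τ a)) (edges (τ b))
  step-reversal {a} (fwd (_ , _ , _ , flip)) = flip-reversal (inj a) flip
  step-reversal {b = b} (bwd (_ , _ , _ , flip)) = reversal-sym (flip-reversal (inj b) flip)

  step-invariant : ∀ {a b : Matching n k} → SymClosure Step a b → Invariant a → Invariant b
  step-invariant {a} {b} s ((same-adj , same-deg) , same-parity) =
    ((λ x y → trans (reversal-adjacent r x y) (same-adj x y)) , (λ w → trans (reversal-deg r w) (same-deg w))) ,
    (begin
      parity (inversions (τ b))           ≡⟨ parity-inversions (τ b) ⟩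
      crossings (edges (τ b)) (edges (τ b)) ≡⟨ reversal-preserves-crossings (τ m₀) (inj m₀) interlacing r (same-adj , same-deg) ⟩
      crossings (edges (τ a)) (edges (τ a)) ≡⟨ parity-inversions (τ a) ⟨
      parity (inversions (τ a))           ≡⟨ same-parity ⟩
      parity (inversions (τ m₀))          ∎)
    where
    open ≡-Reasoning
    r = step-reversal s

  orbit-invariant : ∀ {m : Matching n k} → SameOrbit m₀ m → Invariant m
  orbit-invariant = along (((λ _ _ → refl) , (λ _ → refl)) , refl)
    where
    along : ∀ {a b : Matching n k} → Invariant a → SameOrbit a b → Invariant b
    along inv Star.ε       = inv
    along inv (s ◅ orbit) = along (step-invariant s inv) orbit

corollary7 : (n k : ℕ) → 1 ≤ k → k ≤ n →
             (m₀ m m′ : Matching n k) → Interlacing m₀ →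
             SameOrbit m₀ m → SameOrbit m₀ m′ → sgn m ≡ sgn m′
corollary7 n k _ _ m₀ m m′ interlacing orbit orbit′ =
  negOnePow-cong (inversions (τ m)) (inversions (τ m′))
    (trans (proj₂ (orbit-invariant m₀ interlacing orbit)) (sym (proj₂ (orbit-invariant m₀ interlacing orbit′))))
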